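{- Let $q \geqslant 3$ be prime, $s \geqslant 1$, and $f: \mathrm{Aff}(q)^{2s} \rightarrow \mathbf{F}_q^+$ the map $(g_1, g_1', \dots, g_s, g_s') \mapsto [g_1,g_1'][g_2,g_2']\cdots[g_s,g_s']$. Then the image of the map $$\{ \mathbf{g} \in \mathrm{Aff}(q)^{2s} : f(\mathbf{g}) \neq 0,\ \mathbf{g} \text{ generates } \mathrm{Aff}(q)\} \rightarrow (\mathbf{F}_q^*)^{2s},$$ sending each $g_i, g_i'$ to its image in the abelian quotient $\mathbf{F}_q^*$, consists precisely of those $2s$-tuples whose entries generate $\mathbf{F}_q^*$, and all fibers over points of the image have the same size.
   Context: $\mathrm{Aff}(q) \cong \mathbf{F}_q^+ \rtimes \mathbf{F}_q^*$ is the group of permutations $x \mapsto ax+b$ of $\mathbf{F}_q$ ($a \in \mathbf{F}_q^*$, $b \in \mathbf{F}_q$); its commutator subgroup is contained in the normal subgroup $\mathbf{F}_q^+$ of translations, and $\mathrm{Aff}(q)/\mathbf{F}_q^+ \cong \mathbf{F}_q^*$. $[x,y] = xyx^{ -1}y^{ -1}$. -}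

module Defs where

open import Data.Nat using (ℕ; zero; suc; _+_; _*_; _∸_; _^_; NonZero)
open import Data.Nat.DivMod using (_mod_)
open import Data.Fin using (Fin; toℕ)
open import Data.Vec using (Vec; []; _∷_; map; foldr)
open import Data.Vec.Membership.Propositional using () renaming (_∈_ to _∈ᵥ_)
open import Data.List using (List; length)
open import Data.List.Membership.Propositional using (_∈_)
open import Data.List.Relation.Unary.Unique.Propositional using (Unique)
open import Data.Product using (Σ; _×_; _,_; proj₁; proj₂)
open import Data.Sum using (_⊎_)
open import Relation.Binary.PropositionalEquality using (_≡_; _≢_)
open import Function.Bundles using (_⇔_)

HasSize : {A : Set} → (A → Set) → ℕ → Set
HasSize {A} P N =
  Σ (List A) λ xs → length xs ≡ N × Unique xs × (∀ x → (x ∈ xs) ⇔ P x)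

module _ (q : ℕ) .{{_ : NonZero q}} where

  F : Set
  F = Fin q

  _⊕_ : F → F → F
  x ⊕ y = (toℕ x + toℕ y) mod q

  _⊗_ : F → F → F
  x ⊗ y = (toℕ x * toℕ y) mod q

  ⊖ : F → F
  ⊖ x = (q ∸ toℕ x) mod q

  0F : F
  0F = 0 mod q

  1F : F
  1F = 1 mod q

  -- multiplicative inverse x^(q-2) (correct for nonzero x, q prime)
  inv : F → F
  inv x = (toℕ x ^ (q ∸ 2)) mod q

  Nonzero : F → Set
  Nonzero x = toℕ x ≢ 0

  -- Affine maps x ↦ a x + b; genuine elements of Aff(q) are those with a ≠ 0.
  record Aff : Set where
    constructor aff
    field
      lin   : F
      trans : F
  open Aff public

  IsAff : Aff → Set
  IsAff g = Nonzero (lin g)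

  -- product = composition of permutations: (g · h)(x) = g (h x)
  _·_ : Aff → Aff → Aff
  aff a b · aff c d = aff (a ⊗ c) ((a ⊗ d) ⊕ b)

  e : Aff
  e = aff 1F 0F

  _⁻¹ : Aff → Aff
  aff a b ⁻¹ = aff (inv a) (⊖ (inv a ⊗ b))

  ⟦_,_⟧ : Aff → Aff → Aff
  ⟦ x , y ⟧ = ((x · y) · (x ⁻¹)) · (y ⁻¹)

  f : ∀ {s} → Vec (Aff × Aff) s → Aff
  f [] = e
  f ((x , y) ∷ gs) = ⟦ x , y ⟧ · f gs

  -- the images in the abelian quotient Aff(q)/F_q⁺ ≅ F_q*
  π : ∀ {s} → Vec (Aff × Aff) s → Vec (F × F) s
  π = map (λ { (x , y) → lin x , lin y })

  _∈₂_ : {A : Set} → A → ∀ {s} → Vec (A × A) s → Set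
  _∈₂_ {A} z gs = Σ (A × A) λ p → p ∈ᵥ gs × ((z ≡ proj₁ p) ⊎ (z ≡ proj₂ p))

  data InGenAff {s} (gs : Vec (Aff × Aff) s) : Aff → Set where
    gen  : ∀ {g} → g ∈₂ gs → InGenAff gs g
    unit : InGenAff gs e
    mul  : ∀ {g h} → InGenAff gs g → InGenAff gs h → InGenAff gs (g · h)
    inverse : ∀ {g} → InGenAff gs g → InGenAff gs (g ⁻¹)

  GeneratesAff : ∀ {s} → Vec (Aff × Aff) s → Set
  GeneratesAff gs = ∀ h → IsAff h → InGenAff gs h

  data InGenU {s} (ts : Vec (F × F) s) : F → Set where
    gen  : ∀ {a} → a ∈₂ ts → InGenU ts a
    unit : InGenU ts 1F
    mul  : ∀ {a b} → InGenU ts a → InGenU ts b → InGenU ts (a ⊗ b)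
    inverse : ∀ {a} → InGenU ts a → InGenU ts (inv a)

  GeneratesU : ∀ {s} → Vec (F × F) s → Set
  GeneratesU ts = ∀ a → Nonzero a → InGenU ts a

  AllAff : ∀ {s} → Vec (Aff × Aff) s → Set
  AllAff gs = ∀ g → g ∈₂ gs → IsAff g

  AllU : ∀ {s} → Vec (F × F) s → Set
  AllU ts = ∀ a → a ∈₂ ts → Nonzero a

  Dom : ∀ {s} → Vec (Aff × Aff) s → Set
  Dom gs = AllAff gs × (f gs ≢ e) × GeneratesAff gs

  Fiber : ∀ {s} → Vec (F × F) s → Vec (Aff × Aff) s → Set
  Fiber ts gs = Dom gs × π gs ≡ ts

  InImage : ∀ {s} → Vec (F × F) s → Set
  InImage {s} ts = Σ (Vec (Aff × Aff) s) (Fiber ts)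

-- In Aff(q) the commutator of x ↦ ax + b and x ↦ cx + d is the translation by
-- (1 − c)b + (a − 1)d, so f(g) is the translation by an affine form τ in the translation
-- parts of g whose coefficients only depend on the images of g in 𝔽_q*. If these images
-- generate 𝔽_q* and τ ≠ 0, conjugating the translation by τ with lifts of all of 𝔽_q*
-- yields every translation, hence all of Aff(q); conversely the images of a generating
-- tuple generate 𝔽_q*. Since 𝔽_q* ≠ 1 for q ≥ 3, a generating tuple of images has an
-- entry ≠ 1, so some coefficient of τ is nonzero and τ ≠ 0 cuts out q^{2s−1}(q − 1) of the
-- q^{2s} choices of translation parts, whatever the images are. Inverses in 𝔽_q are x^{q−2},
-- which rests on Fermat's little theorem, obtained from (x + y)^q = x^q + y^q.

module Submission where

open import Defs hiding (trans)
open import Data.Nat as ℕ using (ℕ; zero; suc; _∸_; _<_; _≤_; _!; NonZero; z≤n; s≤s)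
import Data.Nat.Properties as ℕₚ
open import Data.Nat.Divisibility using (_∣_; ∣⇒≤; ∣1⇒≡1; m∣m*n; >⇒∤; m%n≡0⇒n∣m; n∣m⇒m%n≡0)
open import Data.Nat.DivMod using (_%_; _mod_; %-distribˡ-+; %-distribˡ-*; m<n⇒m%n≡m; [m+n]%n≡m%n; m*[n/m]≡n)
open import Data.Nat.Primality using (Prime; euclidsLemma; ¬prime[1]; prime⇒nonTrivial)
open import Data.Nat.Combinatorics using (_C_; nCn≡1; nCk≡n!/k![n-k]!; k![n∸k]!∣n!)
open import Data.Fin as Fin using (Fin; toℕ; fromℕ) renaming (zero to fzero; suc to fsuc)
open import Data.Fin.Properties using (toℕ-injective; toℕ<n; toℕ-fromℕ<; fromℕ<-cong; toℕ-fromℕ; suc-injective)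
open import Data.List as List using (List; []; _∷_; length; _++_; allFin)
open import Data.List.Properties using (length-map; length-++; length-tabulate)
open import Data.List.Membership.Propositional using (_∈_)
open import Data.List.Membership.Propositional.Properties
  using (∈-map⁺; ∈-map⁻; ∈-++⁺ˡ; ∈-++⁺ʳ; ∈-++⁻; ∈-allFin)
open import Data.List.Relation.Unary.Any using (here; there)
import Data.List.Relation.Unary.All as All
open import Data.List.Relation.Unary.Unique.Propositional using (Unique; []; _∷_)
open import Data.List.Relation.Unary.Unique.Propositional.Properties using (map⁺; ++⁺; allFin⁺; Unique[x∷xs]⇒x∉xs)
open import Data.Vec using (Vec; []; _∷_)
open import Data.Vec.Properties using (∷-injective)
open import Data.Vec.Relation.Unary.Any using (here; there)
open import Data.Vec.Membership.Propositional.Properties using () renaming (∈-map⁺ to ∈ᵥ-map⁺)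
open import Data.Vec.Functional using (Vector)
open import Data.Product using (Σ; _×_; _,_; proj₁; proj₂; swap)
open import Data.Sum as Sum using (_⊎_; inj₁; inj₂)
open import Data.Unit using (⊤; tt)
open import Data.Empty using (⊥)
open import Function.Base using (_∘_)
open import Function.Bundles using (_⇔_; mk⇔; Equivalence; _↔_; Inverse; mk↔ₛ′)
open import Relation.Nullary using (¬_; contradiction; yes; no)
open import Relation.Nullary.Decidable using (decidable-stable)
open import Algebra.Bundles using (Monoid; CommutativeSemiring; CommutativeRing)
import Algebra.Solver.CommutativeMonoid
import Relation.Binary.PropositionalEquality as ≡
open ≡ using (_≡_; _≢_; refl; cong; cong₂; subst; ≢-sym; module ≡-Reasoning)

private
  variable
    A B : Set
    P Q : A → Set
    m n : ℕ

-- Cardinalities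

HasSize-cong : (∀ x → P x ⇔ Q x) → HasSize P n → HasSize Q n
HasSize-cong P⇔Q (xs , |xs| , !xs , xs⇔P) =
  xs , |xs| , !xs , λ x → mk⇔ (to (P⇔Q x) ∘ to (xs⇔P x)) (from (xs⇔P x) ∘ from (P⇔Q x))
  where open Equivalence using (to; from)

HasSize-↔ : (A↔B : A ↔ B) → (∀ a → P a ⇔ Q (Inverse.to A↔B a)) → HasSize P n → HasSize Q n
HasSize-↔ {P = P} {Q = Q} A↔B P⇔Q∘to (xs , |xs| , !xs , xs⇔P) =
  List.map to xs , ≡.trans (length-map to xs) |xs| , map⁺ to-injective !xs , λ b → mk⇔ (⇒ b) (⇐ b)
  where
    open Inverse A↔B
    open Equivalence using () renaming (to to ⇒′; from to ⇐′)
    to-injective : ∀ {x y} → to x ≡ to y → x ≡ y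
    to-injective {x} {y} eq = ≡.trans (≡.sym (strictlyInverseʳ x)) (≡.trans (cong from eq) (strictlyInverseʳ y))
    ⇒ : ∀ b → b ∈ List.map to xs → Q b
    ⇒ b b∈ with ∈-map⁻ to b∈
    ... | a , a∈ , refl = ⇒′ (P⇔Q∘to a) (⇒′ (xs⇔P a) a∈)
    ⇐ : ∀ b → Q b → b ∈ List.map to xs
    ⇐ b Qb = subst (_∈ List.map to xs) (strictlyInverseˡ b)
      (∈-map⁺ to (⇐′ (xs⇔P (from b)) (⇐′ (P⇔Q∘to (from b)) (subst Q (≡.sym (strictlyInverseˡ b)) Qb))))

module _ {A B : Set} (ys : A → List B) where

  pairings : List A → List (A × B)
  pairings []       = []
  pairings (a ∷ as) = List.map (a ,_) (ys a) ++ pairings as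

  length-pairings : ∀ {k} → (∀ a → length (ys a) ≡ k) → ∀ as → length (pairings as) ≡ length as ℕ.* k
  length-pairings |ys| []       = refl
  length-pairings |ys| (a ∷ as) = ≡.trans (length-++ (List.map (a ,_) (ys a)))
    (cong₂ ℕ._+_ (≡.trans (length-map (a ,_) (ys a)) (|ys| a)) (length-pairings |ys| as))

  ∈-pairings⁻ : ∀ {a b} as → (a , b) ∈ pairings as → a ∈ as × b ∈ ys a
  ∈-pairings⁻ (a′ ∷ as) ab∈ with ∈-++⁻ (List.map (a′ ,_) (ys a′)) ab∈
  ... | inj₂ ab∈ʳ = let a∈ , b∈ = ∈-pairings⁻ as ab∈ʳ in there a∈ , b∈
  ... | inj₁ ab∈ˡ with ∈-map⁻ (a′ ,_) ab∈ˡ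
  ...   | _ , b∈ , refl = here refl , b∈

  ∈-pairings⁺ : ∀ {a b} as → a ∈ as → b ∈ ys a → (a , b) ∈ pairings as
  ∈-pairings⁺ (a ∷ as) (here refl) b∈ = ∈-++⁺ˡ (∈-map⁺ (a ,_) b∈)
  ∈-pairings⁺ (a′ ∷ as) (there a∈) b∈ = ∈-++⁺ʳ (List.map (a′ ,_) (ys a′)) (∈-pairings⁺ as a∈ b∈)

  pairings⁺ : (∀ a → Unique (ys a)) → ∀ {as} → Unique as → Unique (pairings as)
  pairings⁺ !ys []              = []
  pairings⁺ !ys {a ∷ as} (a∉ ∷ !as) =
    ++⁺ (map⁺ (cong proj₂) (!ys a)) (pairings⁺ !ys !as) disjoint
    where
      disjoint : ∀ {v} → v ∈ List.map (a ,_) (ys a) × v ∈ pairings as → ⊥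
      disjoint (v∈ˡ , v∈ʳ) with ∈-map⁻ (a ,_) v∈ˡ
      ... | _ , _ , refl = Unique[x∷xs]⇒x∉xs (a∉ ∷ !as) (proj₁ (∈-pairings⁻ as v∈ʳ))

HasSize-Σ : {R : A → B → Set} → HasSize P m → (∀ a → HasSize (R a) n) →
            HasSize (λ (ab : A × B) → P (proj₁ ab) × R (proj₁ ab) (proj₂ ab)) (m ℕ.* n)
HasSize-Σ {P = P} {n = n} {R = R} (xs , |xs| , !xs , xs⇔P) R-size =
  pairings ys xs ,
  ≡.trans (length-pairings ys (λ a → proj₁ (proj₂ (R-size a))) xs) (cong (ℕ._* n) |xs|) ,
  pairings⁺ ys (λ a → proj₁ (proj₂ (proj₂ (R-size a)))) !xs ,
  λ (a , b) → mk⇔ (λ ab∈ → let a∈ , b∈ = ∈-pairings⁻ ys xs ab∈ in to (xs⇔P a) a∈ , to (ys⇔R a b) b∈)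
                  (λ (Pa , Rab) → ∈-pairings⁺ ys xs (from (xs⇔P a) Pa) (from (ys⇔R a b) Rab))
  where
    open Equivalence using (to; from)
    ys : _ → List _
    ys a = proj₁ (R-size a)
    ys⇔R : ∀ a b → b ∈ ys a ⇔ R a b
    ys⇔R a = proj₂ (proj₂ (proj₂ (R-size a)))

HasSize-≡ : (a : A) → HasSize (_≡ a) 1
HasSize-≡ a = a ∷ [] , refl , All.[] ∷ [] , λ x → mk⇔ (λ { (here x≡a) → x≡a ; (there ()) }) here

HasSize-Fin : HasSize {Fin n} (λ _ → ⊤) n
HasSize-Fin {n} = allFin n , length-tabulate (λ i → i) , allFin⁺ n , λ i → mk⇔ (λ _ → tt) (λ _ → ∈-allFin i)

HasSize-Fin-toℕ≢0 : HasSize {Fin n} (λ i → toℕ i ≢ 0) (n ∸ 1)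
HasSize-Fin-toℕ≢0 {zero}  = [] , refl , [] , λ ()
HasSize-Fin-toℕ≢0 {suc n} =
  List.map fsuc (allFin n) , ≡.trans (length-map fsuc (allFin n)) (length-tabulate (λ i → i)) ,
  map⁺ suc-injective (allFin⁺ n) , λ i → mk⇔ (⇒ i) (⇐ i)
  where
    ⇒ : ∀ i → i ∈ List.map fsuc (allFin n) → toℕ i ≢ 0
    ⇒ i i∈ with ∈-map⁻ fsuc i∈
    ... | _ , _ , refl = λ ()
    ⇐ : ∀ i → toℕ i ≢ 0 → i ∈ List.map fsuc (allFin n)
    ⇐ fzero    i≢0 = contradiction refl i≢0
    ⇐ (fsuc i) _   = ∈-map⁺ fsuc (∈-allFin i)

HasSize⇒Σ : .{{NonZero n}} → HasSize P n → Σ A P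
HasSize⇒Σ {n = suc _} (x ∷ _ , _ , _ , xs⇔P) = x , Equivalence.to (xs⇔P x) (here refl)

HasSize-∘from : (A↔B : A ↔ B) → HasSize P n → HasSize (P ∘ Inverse.from A↔B) n
HasSize-∘from {P = P} A↔B = HasSize-↔ A↔B λ a →
  mk⇔ (subst P (≡.sym (strictlyInverseʳ a))) (subst P (strictlyInverseʳ a))
  where open Inverse A↔B

∷-↔ : ∀ {s} → (A × Vec A s) ↔ Vec A (suc s)
∷-↔ = mk↔ₛ′ (λ p → proj₁ p ∷ proj₂ p) (λ { (x ∷ xs) → x , xs })
            (λ { (_ ∷ _) → refl }) (λ _ → refl)

∷≡∷⇔ : ∀ {s} {x y : A} {xs ys : Vec A s} → (x ≡ y × xs ≡ ys) ⇔ (x ∷ xs ≡ y ∷ ys)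
∷≡∷⇔ = mk⇔ (λ (x≡y , xs≡ys) → cong₂ _∷_ x≡y xs≡ys) ∷-injective

-- Binomial coefficients modulo a prime and the Frobenius identity

prime∤! : ∀ {p k} → Prime p → k < p → ¬ p ∣ k !
prime∤! {k = zero} pr _ p∣1 = ¬prime[1] (subst Prime (∣1⇒≡1 p∣1) pr)
prime∤! {k = suc k} pr k<p p∣k! with euclidsLemma (suc k) (k !) pr p∣k!
... | inj₁ p∣1+k = ℕₚ.<⇒≱ k<p (∣⇒≤ p∣1+k)
... | inj₂ p∣k!  = prime∤! pr (ℕₚ.<-trans (ℕₚ.n<1+n k) k<p) p∣k!

prime∣C : ∀ {p k} → Prime p → 0 < k → k < p → p ∣ p C k
prime∣C {suc p} {k} pr 0<k k<p with euclidsLemma (k ! ℕ.* (suc p ∸ k) !) (suc p C k) pr p∣denominator*C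
  where
    instance
      k![p-k]!≢0 : NonZero (k ! ℕ.* (suc p ∸ k) !)
      k![p-k]!≢0 = k ℕₚ.!* (suc p ∸ k) !≢0
    p∣denominator*C : suc p ∣ (k ! ℕ.* (suc p ∸ k) !) ℕ.* (suc p C k)
    p∣denominator*C = subst (suc p ∣_)
      (≡.sym (≡.trans (cong ((k ! ℕ.* (suc p ∸ k) !) ℕ.*_) (nCk≡n!/k![n-k]! (ℕₚ.<⇒≤ k<p)))
                  (m*[n/m]≡n (k![n∸k]!∣n! (ℕₚ.<⇒≤ k<p)))))
      (m∣m*n (p !))
... | inj₂ p∣C = p∣C
... | inj₁ p∣denominator with euclidsLemma (k !) ((suc p ∸ k) !) pr p∣denominator
...   | inj₁ p∣k! = contradiction p∣k! (prime∤! pr k<p)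
...   | inj₂ p∣[p-k]! = contradiction p∣[p-k]! (prime∤! pr (ℕₚ.∸-monoʳ-< 0<k (ℕₚ.<⇒≤ k<p)))

module _ {c ℓ} (M : Monoid c ℓ) where
  open Monoid M
  open import Algebra.Properties.Monoid.Sum M using (sum)

  sum≈first∙last : ∀ n (t : Vector Carrier (suc (suc n))) →
                   (∀ i → 0 < toℕ i → toℕ i < suc n → t i ≈ ε) →
                   sum t ≈ t fzero ∙ t (fromℕ (suc n))
  sum≈first∙last zero    t _       = ∙-congˡ (identityʳ _)
  sum≈first∙last (suc n) t inner≈ε = ∙-congˡ (begin
    sum (t ∘ fsuc)                            ≈⟨ sum≈first∙last n (t ∘ fsuc) tail-inner≈ε ⟩
    t (fsuc fzero) ∙ t (fromℕ (suc (suc n)))  ≈⟨ ∙-congʳ (inner≈ε (fsuc fzero) (s≤s z≤n) (s≤s (s≤s z≤n))) ⟩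
    ε ∙ t (fromℕ (suc (suc n)))               ≈⟨ identityˡ _ ⟩
    t (fromℕ (suc (suc n)))                   ∎)
    where
      open import Relation.Binary.Reasoning.Setoid setoid
      tail-inner≈ε : ∀ i → 0 < toℕ i → toℕ i < suc n → t (fsuc i) ≈ ε
      tail-inner≈ε i _ i<n = inner≈ε (fsuc i) (s≤s z≤n) (s≤s i<n)

module _ {c ℓ} (S : CommutativeSemiring c ℓ) where
  open CommutativeSemiring S
  open import Algebra.Properties.Semiring.Exp semiring using (_^_)
  open import Algebra.Properties.Semiring.Mult semiring using () renaming (_×_ to _×′_)
  open import Algebra.Properties.CommutativeSemiring.Binomial S using (theorem; binomialTerm)
  open import Algebra.Properties.Monoid.Sum +-monoid using (sum)
  open import Relation.Binary.Reasoning.Setoid setoid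

  frobenius : ∀ n .{{_ : NonZero n}} → (∀ k z → 0 < k → k < n → (n C k) ×′ z ≈ 0#) →
              ∀ x y → (x + y) ^ n ≈ x ^ n + y ^ n
  frobenius (suc n) interior≈0 x y = begin
    (x + y) ^ suc n                                       ≈⟨ theorem (suc n) x y ⟩
    sum (binomialTerm x y (suc n))                        ≈⟨ sum≈first∙last +-monoid n _ interior-terms≈0 ⟩
    binomialTerm x y (suc n) fzero + binomialTerm x y (suc n) (fromℕ (suc n))
                                                          ≈⟨ +-cong first≈ (last≈ _ (toℕ-fromℕ (suc n))) ⟩
    y ^ suc n + x ^ suc n                                 ≈⟨ +-comm _ _ ⟩
    x ^ suc n + y ^ suc n                                 ∎
    where
      interior-terms≈0 : ∀ i → 0 < toℕ i → toℕ i < suc n → binomialTerm x y (suc n) i ≈ 0#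
      interior-terms≈0 i 0<i i<n = interior≈0 (toℕ i) _ 0<i i<n
      first≈ : (1# * y ^ suc n) + 0# ≈ y ^ suc n
      first≈ = trans (+-identityʳ _) (*-identityˡ _)
      last≈ : ∀ k → k ≡ suc n → (suc n C k) ×′ (x ^ k * y ^ (suc n ∸ k)) ≈ x ^ suc n
      last≈ _ refl = begin
        (suc n C suc n) ×′ (x ^ suc n * y ^ (suc n ∸ suc n))
          ≡⟨ cong (_×′ (x ^ suc n * y ^ (suc n ∸ suc n))) (nCn≡1 (suc n)) ⟩
        x ^ suc n * y ^ (suc n ∸ suc n) + 0#                  ≈⟨ +-identityʳ _ ⟩
        x ^ suc n * y ^ (suc n ∸ suc n)                       ≡⟨ cong (λ j → x ^ suc n * y ^ j) (ℕₚ.n∸n≡0 (suc n)) ⟩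
        x ^ suc n * 1#                                        ≈⟨ *-identityʳ _ ⟩
        x ^ suc n                                             ∎

-- The ring ℤ/qℤ

module _ (q : ℕ) .{{_ : NonZero q}} where

  private
    infixl 6 _+q_
    infixl 7 _*q_
    _+q_ = _⊕_ q
    _*q_ = _⊗_ q
    [_] : ℕ → F q
    [ n ] = n mod q

  mod-≡ : ∀ {m n} → m % q ≡ n % q → [ m ] ≡ [ n ]
  mod-≡ {m} {n} eq = fromℕ<-cong (m % q) (n % q) eq _ _

  toℕ-mod : ∀ n → toℕ [ n ] ≡ n % q
  toℕ-mod n = toℕ-fromℕ< _

  toℕ-mod-inverse : ∀ (x : F q) → [ toℕ x ] ≡ x
  toℕ-mod-inverse x = toℕ-injective (≡.trans (toℕ-mod (toℕ x)) (m<n⇒m%n≡m (toℕ<n x)))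

  mod-homo-+ : ∀ m n → [ m ℕ.+ n ] ≡ [ m ] +q [ n ]
  mod-homo-+ m n = mod-≡ (≡.trans (%-distribˡ-+ m n q)
    (cong₂ (λ a b → (a ℕ.+ b) % q) (≡.sym (toℕ-mod m)) (≡.sym (toℕ-mod n))))

  mod-homo-* : ∀ m n → [ m ℕ.* n ] ≡ [ m ] *q [ n ]
  mod-homo-* m n = mod-≡ (≡.trans (%-distribˡ-* m n q)
    (cong₂ (λ a b → (a ℕ.* b) % q) (≡.sym (toℕ-mod m)) (≡.sym (toℕ-mod n))))

  mod-elim : (P : F q → Set) → (∀ n → P [ n ]) → ∀ x → P x
  mod-elim P h x = subst P (toℕ-mod-inverse x) (h (toℕ x))

  mod-elim₂ : (P : F q → F q → Set) → (∀ m n → P [ m ] [ n ]) → ∀ x y → P x y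
  mod-elim₂ P h x = mod-elim (λ x → ∀ y → P x y) (λ m → mod-elim (P [ m ]) (h m)) x

  mod-elim₃ : (P : F q → F q → F q → Set) → (∀ m n k → P [ m ] [ n ] [ k ]) → ∀ x y z → P x y z
  mod-elim₃ P h x = mod-elim (λ x → ∀ y z → P x y z) (λ m → mod-elim₂ (P [ m ]) (h m)) x

  open ≡-Reasoning

  +q-assoc : ∀ x y z → (x +q y) +q z ≡ x +q (y +q z)
  +q-assoc = mod-elim₃ _ λ m n k → begin
    ([ m ] +q [ n ]) +q [ k ]  ≡⟨ cong (_+q [ k ]) (mod-homo-+ m n) ⟨
    [ m ℕ.+ n ] +q [ k ]       ≡⟨ mod-homo-+ (m ℕ.+ n) k ⟨
    [ m ℕ.+ n ℕ.+ k ]          ≡⟨ cong [_] (ℕₚ.+-assoc m n k) ⟩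
    [ m ℕ.+ (n ℕ.+ k) ]        ≡⟨ mod-homo-+ m (n ℕ.+ k) ⟩
    [ m ] +q [ n ℕ.+ k ]       ≡⟨ cong ([ m ] +q_) (mod-homo-+ n k) ⟩
    [ m ] +q ([ n ] +q [ k ])  ∎

  *q-assoc : ∀ x y z → (x *q y) *q z ≡ x *q (y *q z)
  *q-assoc = mod-elim₃ _ λ m n k → begin
    ([ m ] *q [ n ]) *q [ k ]  ≡⟨ cong (_*q [ k ]) (mod-homo-* m n) ⟨
    [ m ℕ.* n ] *q [ k ]       ≡⟨ mod-homo-* (m ℕ.* n) k ⟨
    [ m ℕ.* n ℕ.* k ]          ≡⟨ cong [_] (ℕₚ.*-assoc m n k) ⟩
    [ m ℕ.* (n ℕ.* k) ]        ≡⟨ mod-homo-* m (n ℕ.* k) ⟩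
    [ m ] *q [ n ℕ.* k ]       ≡⟨ cong ([ m ] *q_) (mod-homo-* n k) ⟩
    [ m ] *q ([ n ] *q [ k ])  ∎

  +q-comm : ∀ x y → x +q y ≡ y +q x
  +q-comm x y = cong [_] (ℕₚ.+-comm (toℕ x) (toℕ y))

  *q-comm : ∀ x y → x *q y ≡ y *q x
  *q-comm x y = cong [_] (ℕₚ.*-comm (toℕ x) (toℕ y))

  +q-identityˡ : ∀ x → 0F q +q x ≡ x
  +q-identityˡ = mod-elim _ λ n → ≡.sym (mod-homo-+ 0 n)

  *q-identityˡ : ∀ x → 1F q *q x ≡ x
  *q-identityˡ = mod-elim _ λ n → ≡.trans (≡.sym (mod-homo-* 1 n)) (cong [_] (ℕₚ.*-identityˡ n))

  ⊖-inverseˡ : ∀ x → ⊖ q x +q x ≡ 0F q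
  ⊖-inverseˡ x = begin
    [ q ∸ toℕ x ] +q x          ≡⟨ cong ([ q ∸ toℕ x ] +q_) (toℕ-mod-inverse x) ⟨
    [ q ∸ toℕ x ] +q [ toℕ x ]  ≡⟨ mod-homo-+ (q ∸ toℕ x) (toℕ x) ⟨
    [ q ∸ toℕ x ℕ.+ toℕ x ]     ≡⟨ cong [_] (ℕₚ.m∸n+n≡m (ℕₚ.<⇒≤ (toℕ<n x))) ⟩
    [ q ]                       ≡⟨ mod-≡ ([m+n]%n≡m%n 0 q) ⟩
    [ 0 ]                       ∎

  *q-distribˡ-+q : ∀ x y z → x *q (y +q z) ≡ x *q y +q x *q z
  *q-distribˡ-+q = mod-elim₃ _ λ m n k → begin
    [ m ] *q ([ n ] +q [ k ])         ≡⟨ cong ([ m ] *q_) (mod-homo-+ n k) ⟨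
    [ m ] *q [ n ℕ.+ k ]              ≡⟨ mod-homo-* m (n ℕ.+ k) ⟨
    [ m ℕ.* (n ℕ.+ k) ]               ≡⟨ cong [_] (ℕₚ.*-distribˡ-+ m n k) ⟩
    [ m ℕ.* n ℕ.+ m ℕ.* k ]           ≡⟨ mod-homo-+ (m ℕ.* n) (m ℕ.* k) ⟩
    [ m ℕ.* n ] +q [ m ℕ.* k ]        ≡⟨ cong₂ _+q_ (mod-homo-* m n) (mod-homo-* m k) ⟩
    [ m ] *q [ n ] +q [ m ] *q [ k ]  ∎

  ℤ/qℤ : CommutativeRing _ _
  ℤ/qℤ = record
    { Carrier = F q ; _≈_ = _≡_ ; _+_ = _+q_ ; _*_ = _*q_ ; -_ = ⊖ q ; 0# = 0F q ; 1# = 1F q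
    ; isCommutativeRing = isCommutativeRing }
    where
      open import Algebra.Structures {A = F q} _≡_ using (IsCommutativeRing)
      open import Algebra.Consequences.Propositional using (comm∧idˡ⇒id; comm∧invˡ⇒inv; comm∧distrˡ⇒distrʳ)
      isCommutativeRing : IsCommutativeRing _+q_ _*q_ (⊖ q) (0F q) (1F q)
      isCommutativeRing = record
        { isRing = record
          { +-isAbelianGroup = record
            { isGroup = record
              { isMonoid = record
                { isSemigroup = record
                  { isMagma = record { isEquivalence = ≡.isEquivalence ; ∙-cong = cong₂ _+q_ }
                  ; assoc = +q-assoc }
                ; identity = comm∧idˡ⇒id +q-comm +q-identityˡ }
              ; inverse = comm∧invˡ⇒inv +q-comm ⊖-inverseˡ
              ; ⁻¹-cong = cong (⊖ q) }
            ; comm = +q-comm }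
          ; *-cong = cong₂ _*q_
          ; *-assoc = *q-assoc
          ; *-identity = comm∧idˡ⇒id *q-comm *q-identityˡ
          ; distrib = *q-distribˡ-+q , comm∧distrˡ⇒distrʳ *q-comm *q-distribˡ-+q }
        ; *-comm = *q-comm }

  toℕ-0F : toℕ (0F q) ≡ 0
  toℕ-0F = ≡.trans (toℕ-mod 0) (m<n⇒m%n≡m (ℕ.>-nonZero⁻¹ q))

  mod-multiple≡0F : ∀ {n} → q ∣ n → [ n ] ≡ 0F q
  mod-multiple≡0F {n} q∣n = mod-≡ (≡.trans (n∣m⇒m%n≡0 n q q∣n) (≡.sym (m<n⇒m%n≡m (ℕ.>-nonZero⁻¹ q))))

  ¬Nonzero⇒≡0F : ∀ {x} → ¬ Nonzero q x → x ≡ 0F q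
  ¬Nonzero⇒≡0F {x} x≡0 = toℕ-injective (≡.trans (decidable-stable (toℕ x ℕ.≟ 0) x≡0) (≡.sym toℕ-0F))

module _ (q : ℕ) .{{_ : NonZero q}} where
  open CommutativeRing (ℤ/qℤ q) hiding (refl; sym; trans)
  open import Algebra.Properties.Semiring.Exp semiring using (_^_)
  open import Algebra.Properties.Semiring.Mult semiring using () renaming (_×_ to _×′_)
  open ≡-Reasoning

  ×′≡mod* : ∀ n x → n ×′ x ≡ n mod q * x
  ×′≡mod* zero    x = ≡.sym (zeroˡ x)
  ×′≡mod* (suc n) x = begin
    x + n ×′ x            ≡⟨ cong (x +_) (×′≡mod* n x) ⟩
    x + n mod q * x       ≡⟨ cong (_+ n mod q * x) (*-identityˡ x) ⟨
    1# * x + n mod q * x  ≡⟨ distribʳ x 1# (n mod q) ⟨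
    (1# + n mod q) * x    ≡⟨ cong (_* x) (mod-homo-+ q 1 n) ⟨
    suc n mod q * x       ∎

  mod-homo-^ : ∀ n k → (n ℕ.^ k) mod q ≡ (n mod q) ^ k
  mod-homo-^ n zero    = refl
  mod-homo-^ n (suc k) = ≡.trans (mod-homo-* q n (n ℕ.^ k)) (cong (n mod q *_) (mod-homo-^ n k))

  1#^n≡1# : ∀ k → 1# ^ k ≡ 1#
  1#^n≡1# zero    = refl
  1#^n≡1# (suc k) = ≡.trans (*-identityˡ _) (1#^n≡1# k)

-- Fermat's little theorem and inverses in 𝔽_q

module _ (q : ℕ) .{{_ : NonZero q}} (q-prime : Prime q) where
  open CommutativeRing (ℤ/qℤ q) hiding (refl; sym; trans)
  open import Algebra.Properties.Ring ring
    using (x∙y⁻¹≈ε⇒x≈y; -‿distribˡ-*; -‿distribʳ-*; //-rightDividesˡ; //-rightDividesʳ)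
  open import Algebra.Properties.Semiring.Exp semiring using (_^_)
  open import Algebra.Properties.Semiring.Mult semiring using () renaming (_×_ to _×′_)
  open ≡-Reasoning

  [x+y]^q≡x^q+y^q : ∀ x y → (x + y) ^ q ≡ x ^ q + y ^ q
  [x+y]^q≡x^q+y^q = frobenius commutativeSemiring q λ k z 0<k k<q → begin
    (q C k) ×′ z       ≡⟨ ×′≡mod* q (q C k) z ⟩
    (q C k) mod q * z  ≡⟨ cong (_* z) (mod-multiple≡0F q (prime∣C q-prime 0<k k<q)) ⟩
    0# * z             ≡⟨ zeroˡ z ⟩
    0#                 ∎

  ^q≡*^[q-1] : ∀ x → x ^ q ≡ x * x ^ (q ∸ 1)
  ^q≡*^[q-1] x = cong (x ^_) (≡.sym (ℕₚ.m+[n∸m]≡n (ℕ.>-nonZero⁻¹ q)))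

  x^q≡x : ∀ x → x ^ q ≡ x
  x^q≡x = mod-elim q _ residue^q
    where
      residue^q : ∀ n → (n mod q) ^ q ≡ n mod q
      residue^q zero    = ≡.trans (^q≡*^[q-1] 0#) (zeroˡ _)
      residue^q (suc n) = begin
        (suc n mod q) ^ q       ≡⟨ cong (_^ q) (mod-homo-+ q 1 n) ⟩
        (1# + n mod q) ^ q      ≡⟨ [x+y]^q≡x^q+y^q 1# (n mod q) ⟩
        1# ^ q + (n mod q) ^ q  ≡⟨ cong₂ _+_ (1#^n≡1# q q) (residue^q n) ⟩
        1# + n mod q            ≡⟨ mod-homo-+ q 1 n ⟨
        suc n mod q             ∎

  Nonzero⇒∤ : ∀ {x} → Nonzero q x → ¬ q ∣ toℕ x
  Nonzero⇒∤ {x} x≢0 = >⇒∤ {{ℕ.≢-nonZero x≢0}} (toℕ<n x)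

  Nonzero-* : ∀ {x y} → Nonzero q x → Nonzero q y → Nonzero q (x * y)
  Nonzero-* {x} {y} x≢0 y≢0 xy≡0
    with euclidsLemma (toℕ x) (toℕ y) q-prime (m%n≡0⇒n∣m _ q (≡.trans (≡.sym (toℕ-mod q _)) xy≡0))
  ... | inj₁ q∣x = Nonzero⇒∤ x≢0 q∣x
  ... | inj₂ q∣y = Nonzero⇒∤ y≢0 q∣y

  x^[q-1]≡1 : ∀ {x} → Nonzero q x → x ^ (q ∸ 1) ≡ 1#
  x^[q-1]≡1 {x} x≢0 = x∙y⁻¹≈ε⇒x≈y _ _ (¬Nonzero⇒≡0F q λ y≢0 →
    Nonzero-* x≢0 y≢0 (≡.trans (cong toℕ x*[x^[q-1]-1]≡0) (toℕ-0F q)))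
    where
      x*[x^[q-1]-1]≡0 : x * (x ^ (q ∸ 1) - 1#) ≡ 0#
      x*[x^[q-1]-1]≡0 = begin
        x * (x ^ (q ∸ 1) - 1#)       ≡⟨ distribˡ x _ _ ⟩
        x * x ^ (q ∸ 1) + x * - 1#   ≡⟨ cong₂ _+_ (^q≡*^[q-1] x) (-‿distribʳ-* x 1#) ⟨
        x ^ q + - (x * 1#)           ≡⟨ cong₂ (λ a b → a + - b) (x^q≡x x) (*-identityʳ x) ⟩
        x - x                        ≡⟨ -‿inverseʳ x ⟩
        0#                           ∎

  inv-inverseʳ : ∀ {x} → Nonzero q x → x * inv q x ≡ 1#
  inv-inverseʳ {x} x≢0 = begin
    x * inv q x                  ≡⟨ cong (x *_) (mod-homo-^ q (toℕ x) (q ∸ 2)) ⟩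
    x * (toℕ x mod q) ^ (q ∸ 2)  ≡⟨ cong (λ y → x * y ^ (q ∸ 2)) (toℕ-mod-inverse q x) ⟩
    x ^ suc (q ∸ 2)              ≡⟨ cong (x ^_) (ℕₚ.+-∸-assoc 1 2≤q) ⟨
    x ^ (q ∸ 1)                  ≡⟨ x^[q-1]≡1 x≢0 ⟩
    1#                           ∎
    where
      2≤q : 2 ℕ.≤ q
      2≤q = ℕ.nonTrivial⇒n>1 q {{prime⇒nonTrivial q-prime}}

  inv-inverseˡ : ∀ {x} → Nonzero q x → inv q x * x ≡ 1#
  inv-inverseˡ {x} x≢0 = ≡.trans (*-comm _ x) (inv-inverseʳ x≢0)

  inv-cancelˡ : ∀ {x} y → Nonzero q x → x * (inv q x * y) ≡ y
  inv-cancelˡ {x} y x≢0 = begin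
    x * (inv q x * y)   ≡⟨ *-assoc x (inv q x) y ⟨
    (x * inv q x) * y   ≡⟨ cong (_* y) (inv-inverseʳ x≢0) ⟩
    1# * y              ≡⟨ *-identityˡ y ⟩
    y                   ∎

  inv-cancelʳ : ∀ {x} y → Nonzero q x → inv q x * (x * y) ≡ y
  inv-cancelʳ {x} y x≢0 = begin
    inv q x * (x * y)   ≡⟨ *-assoc (inv q x) x y ⟨
    (inv q x * x) * y   ≡⟨ cong (_* y) (inv-inverseˡ x≢0) ⟩
    1# * y              ≡⟨ *-identityˡ y ⟩
    y                   ∎

  Nonzero-*⁻ˡ : ∀ {x y} → Nonzero q (x * y) → Nonzero q x
  Nonzero-*⁻ˡ {x} {y} xy≢0 x≡0 = xy≢0 (begin
    toℕ (x * y)     ≡⟨ cong (λ z → toℕ (z * y)) (¬Nonzero⇒≡0F q (λ x≢0 → x≢0 x≡0)) ⟩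
    toℕ (0# * y)    ≡⟨ cong toℕ (zeroˡ y) ⟩
    toℕ 0#          ≡⟨ toℕ-0F q ⟩
    0               ∎)

  -- Commutators and generating tuples in Aff(q)

  private
    infixl 7 _∙_
    _∙_ : Aff q → Aff q → Aff q
    _∙_ = _·_ q
    _⁻¹ᵃ : Aff q → Aff q
    _⁻¹ᵃ = _⁻¹ q

  commTrans : Aff q → Aff q → F q
  commTrans x y = (1# - lin y) * Aff.trans x + (lin x - 1#) * Aff.trans y

  ⟦,⟧≡translation : ∀ {x y} → IsAff q x → IsAff q y → ⟦_,_⟧ q x y ≡ aff 1# (commTrans x y)
  ⟦,⟧≡translation {aff a b} {aff c d} a≢0 c≢0 = cong₂ aff linear-part translation-part
    where
      ac/a≡c : (a * c) * inv q a ≡ c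
      ac/a≡c = ≡.trans (*-comm _ (inv q a)) (inv-cancelʳ c a≢0)
      linear-part : ((a * c) * inv q a) * inv q c ≡ 1#
      linear-part = ≡.trans (cong (_* inv q c) ac/a≡c) (inv-inverseʳ c≢0)
      undo-d : ((a * c) * inv q a) * - (inv q c * d) ≡ - d
      undo-d = begin
        ((a * c) * inv q a) * - (inv q c * d)  ≡⟨ cong (_* - (inv q c * d)) ac/a≡c ⟩
        c * - (inv q c * d)                    ≡⟨ -‿distribʳ-* c _ ⟨
        - (c * (inv q c * d))                  ≡⟨ cong -_ (inv-cancelˡ d c≢0) ⟩
        - d                                    ∎
      undo-b : (a * c) * - (inv q a * b) ≡ - (c * b)
      undo-b = begin
        (a * c) * - (inv q a * b)    ≡⟨ -‿distribʳ-* (a * c) _ ⟨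
        - ((a * c) * (inv q a * b))  ≡⟨ cong -_ (*-assoc (a * c) (inv q a) b) ⟨
        - (((a * c) * inv q a) * b)  ≡⟨ cong (λ z → - (z * b)) ac/a≡c ⟩
        - (c * b)                    ∎
      translation-part : ((a * c) * inv q a) * - (inv q c * d) + ((a * c) * - (inv q a * b) + (a * d + b))
                       ≡ (1# - c) * b + (a - 1#) * d
      translation-part = begin
        ((a * c) * inv q a) * - (inv q c * d) + ((a * c) * - (inv q a * b) + (a * d + b))
          ≡⟨ cong₂ (λ u v → u + (v + (a * d + b))) undo-d undo-b ⟩
        - d + (- (c * b) + (a * d + b))
          ≡⟨ +-solve 4 (λ x y z w → (x ⊞ (y ⊞ (z ⊞ w))) ⊜ ((w ⊞ y) ⊞ (z ⊞ x))) refl (- d) (- (c * b)) (a * d) b ⟩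
        (b - c * b) + (a * d - d)
          ≡⟨ cong₂ _+_ [1-c]*b [a-1]*d ⟨
        (1# - c) * b + (a - 1#) * d      ∎
        where
          open Algebra.Solver.CommutativeMonoid +-commutativeMonoid
            using (_⊜_) renaming (solve to +-solve; _⊕_ to _⊞_)
          [1-c]*b : (1# - c) * b ≡ b - c * b
          [1-c]*b = ≡.trans (distribʳ b 1# (- c)) (cong₂ _+_ (*-identityˡ b) (≡.sym (-‿distribˡ-* c b)))
          [a-1]*d : (a - 1#) * d ≡ a * d - d
          [a-1]*d = ≡.trans (distribʳ d a (- 1#))
                            (cong (a * d +_) (≡.trans (≡.sym (-‿distribˡ-* 1# d)) (cong -_ (*-identityˡ d))))

  translation-conj : ∀ g τ → IsAff q g → (g ∙ aff 1# τ) ∙ g ⁻¹ᵃ ≡ aff 1# (lin g * τ)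
  translation-conj (aff a b) τ a≢0 = cong₂ aff linear-part translation-part
    where
      linear-part : (a * 1#) * inv q a ≡ 1#
      linear-part = ≡.trans (cong (_* inv q a) (*-identityʳ a)) (inv-inverseʳ a≢0)
      translation-part : (a * 1#) * - (inv q a * b) + (a * τ + b) ≡ a * τ
      translation-part = begin
        (a * 1#) * - (inv q a * b) + (a * τ + b)  ≡⟨ cong (λ z → z * - (inv q a * b) + (a * τ + b)) (*-identityʳ a) ⟩
        a * - (inv q a * b) + (a * τ + b)         ≡⟨ cong (_+ (a * τ + b)) (-‿distribʳ-* a _) ⟨
        - (a * (inv q a * b)) + (a * τ + b)       ≡⟨ cong (λ z → - z + (a * τ + b)) (inv-cancelˡ b a≢0) ⟩
        - b + (a * τ + b)                         ≡⟨ +-comm (- b) _ ⟩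
        (a * τ + b) - b                           ≡⟨ //-rightDividesʳ b (a * τ) ⟩
        a * τ                                     ∎

  ∙-translation : ∀ g h → lin g ≡ lin h → IsAff q h →
                  g ∙ aff 1# (inv q (lin h) * (Aff.trans h - Aff.trans g)) ≡ h
  ∙-translation (aff a b) (aff .a b′) refl a≢0 = cong₂ aff (*-identityʳ a) (begin
    a * (inv q a * (b′ - b)) + b  ≡⟨ cong (_+ b) (inv-cancelˡ (b′ - b) a≢0) ⟩
    (b′ - b) + b                  ≡⟨ //-rightDividesˡ b b′ ⟩
    b′                            ∎)

  ∈₂-head₁ : ∀ {A : Set} {s} (x y : A) {gs : Vec (A × A) s} → _∈₂_ q x ((x , y) ∷ gs)
  ∈₂-head₁ x y = (x , y) , here refl , inj₁ refl

  ∈₂-head₂ : ∀ {A : Set} {s} (x y : A) {gs : Vec (A × A) s} → _∈₂_ q y ((x , y) ∷ gs)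
  ∈₂-head₂ x y = (x , y) , here refl , inj₂ refl

  ∈₂-tail : ∀ {A : Set} {s} {z : A} {p} {gs : Vec (A × A) s} → _∈₂_ q z gs → _∈₂_ q z (p ∷ gs)
  ∈₂-tail (r , r∈ , z∈r) = r , there r∈ , z∈r

  fTrans : ∀ {s} → Vec (Aff q × Aff q) s → F q
  fTrans []             = 0#
  fTrans ((x , y) ∷ gs) = commTrans x y + fTrans gs

  f≡translation : ∀ {s} (gs : Vec (Aff q × Aff q) s) → AllAff q gs → f q gs ≡ aff 1# (fTrans gs)
  f≡translation []             _       = refl
  f≡translation ((x , y) ∷ gs) all-aff = begin
    ⟦_,_⟧ q x y ∙ f q gs
      ≡⟨ cong₂ _∙_ (⟦,⟧≡translation (all-aff x (∈₂-head₁ x y)) (all-aff y (∈₂-head₂ x y)))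
                   (f≡translation gs (λ g → all-aff g ∘ ∈₂-tail)) ⟩
    aff 1# (commTrans x y) ∙ aff 1# (fTrans gs)
      ≡⟨ cong₂ aff (*-identityˡ 1#) (cong (_+ commTrans x y) (*-identityˡ _)) ⟩
    aff 1# (fTrans gs + commTrans x y)
      ≡⟨ cong (aff 1#) (+-comm (fTrans gs) (commTrans x y)) ⟩
    aff 1# (fTrans ((x , y) ∷ gs))
      ∎

  ∈₂-π⁺ : ∀ {s g} (gs : Vec (Aff q × Aff q) s) → _∈₂_ q g gs → _∈₂_ q (lin g) (π q gs)
  ∈₂-π⁺ gs ((x , y) , p∈ , inj₁ refl) = (lin x , lin y) , ∈ᵥ-map⁺ _ p∈ , inj₁ refl
  ∈₂-π⁺ gs ((x , y) , p∈ , inj₂ refl) = (lin x , lin y) , ∈ᵥ-map⁺ _ p∈ , inj₂ refl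

  ∈₂-π⁻ : ∀ {s a} (gs : Vec (Aff q × Aff q) s) → _∈₂_ q a (π q gs) →
          Σ (Aff q) λ g → _∈₂_ q g gs × lin g ≡ a
  ∈₂-π⁻ ((x , y) ∷ gs) (_ , here refl , inj₁ refl) = x , ∈₂-head₁ x y , refl
  ∈₂-π⁻ ((x , y) ∷ gs) (_ , here refl , inj₂ refl) = y , ∈₂-head₂ x y , refl
  ∈₂-π⁻ ((x , y) ∷ gs) (r , there r∈ , a∈r) =
    let g , g∈ , lin-g = ∈₂-π⁻ gs (r , r∈ , a∈r) in g , ∈₂-tail g∈ , lin-g

  lin-InGenAff : ∀ {s g} {gs : Vec (Aff q × Aff q) s} → InGenAff q gs g → InGenU q (π q gs) (lin g)
  lin-InGenAff {gs = gs} (gen g∈) = gen (∈₂-π⁺ gs g∈)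
  lin-InGenAff unit             = unit
  lin-InGenAff (mul g∈ h∈)      = mul (lin-InGenAff g∈) (lin-InGenAff h∈)
  lin-InGenAff (inverse g∈)     = inverse (lin-InGenAff g∈)

  InGenU-lift : ∀ {s a} {gs : Vec (Aff q × Aff q) s} → InGenU q (π q gs) a →
                Σ (Aff q) λ g → InGenAff q gs g × lin g ≡ a
  InGenU-lift {gs = gs} (gen a∈) = let g , g∈ , lin-g = ∈₂-π⁻ gs a∈ in g , gen g∈ , lin-g
  InGenU-lift unit = e q , unit , refl
  InGenU-lift (mul a∈ b∈) with InGenU-lift a∈ | InGenU-lift b∈
  ... | g , g∈ , refl | h , h∈ , refl = g ∙ h , mul g∈ h∈ , refl
  InGenU-lift (inverse a∈) with InGenU-lift a∈
  ... | g , g∈ , refl = g ⁻¹ᵃ , inverse g∈ , refl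

  InGenAff-f : ∀ {s t} {gs : Vec (Aff q × Aff q) s} (hs : Vec (Aff q × Aff q) t) →
               (∀ g → _∈₂_ q g hs → _∈₂_ q g gs) → InGenAff q gs (f q hs)
  InGenAff-f []             _     = unit
  InGenAff-f {gs = gs} ((x , y) ∷ hs) hs⊆gs =
    mul (mul (mul (mul x∈ y∈) (inverse x∈)) (inverse y∈)) (InGenAff-f hs (λ g → hs⊆gs g ∘ ∈₂-tail))
    where
      x∈ : InGenAff q gs x
      x∈ = gen (hs⊆gs x (∈₂-head₁ x y))
      y∈ : InGenAff q gs y
      y∈ = gen (hs⊆gs y (∈₂-head₂ x y))

  module _ {s} (gs : Vec (Aff q × Aff q) s) (all-aff : AllAff q gs) (π-generates : GeneratesU q (π q gs))
           (τ≢0 : Nonzero q (fTrans gs)) where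

    private
      τ : F q
      τ = fTrans gs

    fTrans-translation∈ : InGenAff q gs (aff 1# τ)
    fTrans-translation∈ = subst (InGenAff q gs) (f≡translation gs all-aff) (InGenAff-f gs (λ _ g∈ → g∈))

    nonzero-translation∈ : ∀ {d} → Nonzero q d → InGenAff q gs (aff 1# d)
    nonzero-translation∈ {d} d≢0 = conjugate∈ (InGenU-lift (π-generates a a≢0))
      where
        a : F q
        a = d * inv q τ
        a*τ≡d : a * τ ≡ d
        a*τ≡d = begin
          (d * inv q τ) * τ  ≡⟨ *-assoc d _ τ ⟩
          d * (inv q τ * τ)  ≡⟨ cong (d *_) (inv-inverseˡ τ≢0) ⟩
          d * 1#             ≡⟨ *-identityʳ d ⟩
          d                  ∎
        a≢0 : Nonzero q a
        a≢0 = Nonzero-*⁻ˡ (subst (Nonzero q) (≡.sym a*τ≡d) d≢0)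
        conjugate∈ : Σ (Aff q) (λ g → InGenAff q gs g × lin g ≡ a) → InGenAff q gs (aff 1# d)
        conjugate∈ (g , g∈ , lin-g) = subst (InGenAff q gs) (begin
          (g ∙ aff 1# τ) ∙ g ⁻¹ᵃ  ≡⟨ translation-conj g τ (subst (Nonzero q) (≡.sym lin-g) a≢0) ⟩
          aff 1# (lin g * τ)      ≡⟨ cong (λ z → aff 1# (z * τ)) lin-g ⟩
          aff 1# (a * τ)          ≡⟨ cong (aff 1#) a*τ≡d ⟩
          aff 1# d                ∎) (mul (mul g∈ fTrans-translation∈) (inverse g∈))

    translation∈ : ∀ d → InGenAff q gs (aff 1# d)
    translation∈ d with toℕ d ℕ.≟ 0
    ... | yes d≡0 = subst (λ z → InGenAff q gs (aff 1# z)) (≡.sym (¬Nonzero⇒≡0F q (λ d≢0 → d≢0 d≡0))) unit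
    ... | no  d≢0 = nonzero-translation∈ d≢0

    generatesAff : GeneratesAff q gs
    generatesAff h h-aff =
      let g , g∈ , lin-g = InGenU-lift (π-generates (lin h) h-aff) in
      subst (InGenAff q gs) (∙-translation g h lin-g h-aff) (mul g∈ (translation∈ _))

  Dom⇔fTrans≢0 : ∀ {s} (gs : Vec (Aff q × Aff q) s) → AllAff q gs → GeneratesU q (π q gs) →
                 Dom q gs ⇔ Nonzero q (fTrans gs)
  Dom⇔fTrans≢0 gs all-aff π-generates = mk⇔
    (λ (_ , f≢e , _) τ≡0 → f≢e (≡.trans (f≡translation gs all-aff) (cong (aff 1#) (¬Nonzero⇒≡0F q λ τ≢0 → τ≢0 τ≡0))))
    (λ τ≢0 → all-aff , (λ f≡e → τ≢0 (toℕ-trans≡0 f≡e)) , generatesAff gs all-aff π-generates τ≢0)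
    where
      toℕ-trans≡0 : f q gs ≡ e q → toℕ (fTrans gs) ≡ 0
      toℕ-trans≡0 f≡e = ≡.trans (cong (toℕ ∘ Aff.trans) (≡.trans (≡.sym (f≡translation gs all-aff)) f≡e)) (toℕ-0F q)

  InImage⇒generators : ∀ {s} (ts : Vec (F q × F q) s) → InImage q ts → AllU q ts × GeneratesU q ts
  InImage⇒generators _ (gs , (all-aff , _ , generates) , refl) =
    (λ a a∈ → let g , g∈ , lin-g = ∈₂-π⁻ gs a∈ in subst (Nonzero q) lin-g (all-aff g g∈)) ,
    (λ a a≢0 → lin-InGenAff (generates (aff a 0#) a≢0))

  -- Counting the fibres

  HasSize-affine : ∀ {α} k → Nonzero q α → HasSize (λ v → Nonzero q (α * v + k)) (q ∸ 1)
  HasSize-affine {α} k α≢0 = HasSize-∘from (mk↔ₛ′ to from to∘from from∘to) HasSize-Fin-toℕ≢0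
    where
      to : F q → F q
      to y = inv q α * (y - k)
      from : F q → F q
      from v = α * v + k
      to∘from : ∀ v → to (from v) ≡ v
      to∘from v = ≡.trans (cong (inv q α *_) (//-rightDividesʳ k (α * v))) (inv-cancelʳ v α≢0)
      from∘to : ∀ y → from (to y) ≡ y
      from∘to y = ≡.trans (cong (_+ k) (inv-cancelˡ (y - k) α≢0)) (//-rightDividesˡ k y)

  HasSize-affine₂ : ∀ α β k → Nonzero q α ⊎ Nonzero q β →
                    HasSize (λ (uv : F q × F q) → Nonzero q (α * proj₁ uv + β * proj₂ uv + k)) (q ℕ.* (q ∸ 1))
  HasSize-affine₂ α β k (inj₂ β≢0) =
    HasSize-cong (λ (u , v) → mk⇔ (subst (Nonzero q) (≡.sym (xy∙z≈y∙xz (α * u) (β * v) k)) ∘ proj₂)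
                                  (λ nz → tt , subst (Nonzero q) (xy∙z≈y∙xz (α * u) (β * v) k) nz))
      (HasSize-Σ HasSize-Fin (λ u → HasSize-affine (α * u + k) β≢0))
    where open import Algebra.Properties.CommutativeSemigroup +-commutativeSemigroup using (xy∙z≈y∙xz)
  HasSize-affine₂ α β k (inj₁ α≢0) =
    HasSize-↔ (mk↔ₛ′ swap swap (λ _ → refl) (λ _ → refl))
      (λ (v , u) → let swapped = cong (_+ k) (+-comm (β * v) (α * u)) in
                   mk⇔ (subst (Nonzero q) swapped) (subst (Nonzero q) (≡.sym swapped)))
      (HasSize-affine₂ β α k (inj₂ α≢0))

  linPair : Aff q × Aff q → F q × F q
  linPair p = lin (proj₁ p) , lin (proj₂ p)

  transPair : Aff q × Aff q → F q × F q
  transPair p = Aff.trans (proj₁ p) , Aff.trans (proj₂ p)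

  HasSize-over : ∀ ac {R : F q × F q → Set} {n} → HasSize R n →
                 HasSize (λ p → linPair p ≡ ac × R (transPair p)) n
  HasSize-over ac {n = n} R-size =
    subst (HasSize _) (ℕₚ.*-identityˡ n) (HasSize-∘from pairs↔ (HasSize-Σ (HasSize-≡ ac) (λ _ → R-size)))
    where
      pairs↔ : ((F q × F q) × (F q × F q)) ↔ (Aff q × Aff q)
      pairs↔ = mk↔ₛ′ (λ ((a , c) , (b , d)) → aff a b , aff c d) (λ p → linPair p , transPair p)
                     (λ _ → refl) (λ _ → refl)

  HasSize-linPair : ∀ ac → HasSize (λ p → linPair p ≡ ac) (q ℕ.* q)
  HasSize-linPair ac = HasSize-cong (λ _ → mk⇔ proj₁ (_, tt , tt))
                                    (HasSize-over ac (HasSize-Σ HasSize-Fin (λ _ → HasSize-Fin)))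

  HasSize-π⁻¹ : ∀ {s} (ts : Vec (F q × F q) s) → HasSize (λ gs → π q gs ≡ ts) ((q ℕ.* q) ℕ.^ s)
  HasSize-π⁻¹ []       = HasSize-cong (λ { [] → mk⇔ (λ _ → refl) (λ _ → refl) }) (HasSize-≡ [])
  HasSize-π⁻¹ (t ∷ ts) =
    HasSize-↔ ∷-↔ (λ ((x , y) , gs) → ∷≡∷⇔) (HasSize-Σ (HasSize-linPair t) (λ _ → HasSize-π⁻¹ ts))

  commTrans-over : ∀ {a c} (p : Aff q × Aff q) → linPair p ≡ (a , c) →
                   commTrans (proj₁ p) (proj₂ p) ≡ (1# - c) * Aff.trans (proj₁ p) + (a - 1#) * Aff.trans (proj₂ p)
  commTrans-over _ refl = refl

  commTrans-over-1 : ∀ (p : Aff q × Aff q) → linPair p ≡ (1# , 1#) → commTrans (proj₁ p) (proj₂ p) ≡ 0#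
  commTrans-over-1 (aff _ b , aff _ d) refl = begin
    (1# - 1#) * b + (1# - 1#) * d  ≡⟨ cong₂ (λ u v → u * b + v * d) (-‿inverseʳ 1#) (-‿inverseʳ 1#) ⟩
    0# * b + 0# * d                ≡⟨ cong₂ _+_ (zeroˡ b) (zeroˡ d) ⟩
    0# + 0#                        ≡⟨ +-identityˡ 0# ⟩
    0#                             ∎

  ≢⇒Nonzero-diff : ∀ {a b} → a ≢ b → Nonzero q (a - b)
  ≢⇒Nonzero-diff a≢b a-b≡0 = a≢b (x∙y⁻¹≈ε⇒x≈y _ _ (¬Nonzero⇒≡0F q (λ a-b≢0 → a-b≢0 a-b≡0)))

  HasSize-commTrans : ∀ {a c} k → a ≢ 1# ⊎ c ≢ 1# →
    HasSize (λ p → linPair p ≡ (a , c) × Nonzero q (commTrans (proj₁ p) (proj₂ p) + k)) (q ℕ.* (q ∸ 1))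
  HasSize-commTrans {a} {c} k a≢1⊎c≢1 =
    HasSize-cong (λ p → mk⇔ (λ (over , nz) → over , subst (Nonzero q ∘ (_+ k)) (≡.sym (commTrans-over p over)) nz)
                            (λ (over , nz) → over , subst (Nonzero q ∘ (_+ k)) (commTrans-over p over) nz))
      (HasSize-over (a , c) (HasSize-affine₂ (1# - c) (a - 1#) k
        (Sum.swap (Sum.map ≢⇒Nonzero-diff (≢⇒Nonzero-diff ∘ ≢-sym) a≢1⊎c≢1))))

  -- The shift w lets the induction on the tuple absorb the head commutator into w.
  ShiftedFiber : ∀ {s} → Vec (F q × F q) s → F q → Vec (Aff q × Aff q) s → Set
  ShiftedFiber ts w gs = π q gs ≡ ts × Nonzero q (fTrans gs + w)

  HasSize-ShiftedFiber-nontrivial : ∀ {s a c} (ts : Vec (F q × F q) s) w → a ≢ 1# ⊎ c ≢ 1# →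
    HasSize (ShiftedFiber ((a , c) ∷ ts) w) ((q ℕ.* q) ℕ.^ s ℕ.* (q ℕ.* (q ∸ 1)))
  HasSize-ShiftedFiber-nontrivial ts w a≢1⊎c≢1 =
    HasSize-↔ (mk↔ₛ′ (λ x → proj₂ x ∷ proj₁ x) (λ { (p ∷ gs) → gs , p }) (λ { (_ ∷ _) → refl }) (λ _ → refl))
      (λ (gs , (x , y)) → mk⇔
        (λ (π≡ , over , nz) → to ∷≡∷⇔ (over , π≡) , subst (Nonzero q) (≡.sym (+-assoc _ _ w)) nz)
        (λ (π≡ , nz) → let over , π≡′ = from ∷≡∷⇔ π≡ in π≡′ , over , subst (Nonzero q) (+-assoc _ _ w) nz))
      (HasSize-Σ (HasSize-π⁻¹ ts) (λ gs → HasSize-commTrans (fTrans gs + w) a≢1⊎c≢1))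
    where open Equivalence using (to; from)

  HasSize-ShiftedFiber-trivial : ∀ {s n} (ts : Vec (F q × F q) s) w → HasSize (ShiftedFiber ts w) n →
    HasSize (ShiftedFiber ((1# , 1#) ∷ ts) w) ((q ℕ.* q) ℕ.* n)
  HasSize-ShiftedFiber-trivial ts w tail-size =
    HasSize-↔ ∷-↔
      (λ ((x , y) , gs) → let absorb over = cong (_+ w) (≡.trans (cong (_+ fTrans gs) (commTrans-over-1 (x , y) over))
                                                                 (+-identityˡ (fTrans gs))) in mk⇔
        (λ (over , π≡ , nz) → to ∷≡∷⇔ (over , π≡) , subst (Nonzero q) (≡.sym (absorb over)) nz)
        (λ (π≡ , nz) → let over , π≡′ = from ∷≡∷⇔ π≡ in over , π≡′ , subst (Nonzero q) (absorb over) nz))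
      (HasSize-Σ (HasSize-linPair (1# , 1#)) (λ _ → tail-size))
    where open Equivalence using (to; from)

  AllOne : ∀ {s} → Vec (F q × F q) s → Set
  AllOne ts = ∀ a → _∈₂_ q a ts → a ≡ 1#

  ¬AllOne-tail : ∀ {s} {ts : Vec (F q × F q) s} → ¬ AllOne ((1# , 1#) ∷ ts) → ¬ AllOne ts
  ¬AllOne-tail not-all-one all-one = not-all-one λ
    { _ (_ , here refl , inj₁ refl) → refl
    ; _ (_ , here refl , inj₂ refl) → refl
    ; a (r , there r∈ , a∈r)       → all-one a (r , r∈ , a∈r) }

  -- Indexed by the tuple length minus one.
  fiberSize : ℕ → ℕ
  fiberSize s = (q ℕ.* q) ℕ.^ s ℕ.* (q ℕ.* (q ∸ 1))

  HasSize-ShiftedFiber : ∀ {s} (ts : Vec (F q × F q) (suc s)) → ¬ AllOne ts → ∀ w →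
                         HasSize (ShiftedFiber ts w) (fiberSize s)
  HasSize-ShiftedFiber ((a , c) ∷ ts) not-all-one w with a Fin.≟ 1# | c Fin.≟ 1#
  ... | no a≢1   | _        = HasSize-ShiftedFiber-nontrivial ts w (inj₁ a≢1)
  ... | yes _    | no c≢1   = HasSize-ShiftedFiber-nontrivial ts w (inj₂ c≢1)
  ... | yes refl | yes refl with ts
  ...   | []    = contradiction (λ _ ()) (¬AllOne-tail not-all-one)
  ...   | _ ∷ _ = subst (HasSize _) (≡.sym (ℕₚ.*-assoc (q ℕ.* q) _ _))
                    (HasSize-ShiftedFiber-trivial _ w (HasSize-ShiftedFiber _ (¬AllOne-tail not-all-one) w))

  ShiftedFiber⇔Fiber : ∀ {s} (ts : Vec (F q × F q) s) → AllU q ts → GeneratesU q ts →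
                       ∀ gs → ShiftedFiber ts 0# gs ⇔ Fiber q ts gs
  ShiftedFiber⇔Fiber ts all-u generates gs = mk⇔
    (λ (π≡ , nz) → Equivalence.from (Dom⇔ π≡) (subst (Nonzero q) (+-identityʳ _) nz) , π≡)
    (λ (dom , π≡) → π≡ , subst (Nonzero q) (≡.sym (+-identityʳ _)) (Equivalence.to (Dom⇔ π≡) dom))
    where
      Dom⇔ : π q gs ≡ ts → Dom q gs ⇔ Nonzero q (fTrans gs)
      Dom⇔ refl = Dom⇔fTrans≢0 gs (λ g g∈ → all-u (lin g) (∈₂-π⁺ gs g∈)) generates

  module _ (3≤q : 3 ℕ.≤ q) where

    private
      1<q : 1 < q
      1<q = ℕₚ.<-trans (s≤s (s≤s z≤n)) 3≤q

      toℕ-1# : toℕ 1# ≡ 1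
      toℕ-1# = ≡.trans (toℕ-mod q 1) (m<n⇒m%n≡m 1<q)

    GeneratesU⇒¬AllOne : ∀ {s} {ts : Vec (F q × F q) s} → GeneratesU q ts → ¬ AllOne ts
    GeneratesU⇒¬AllOne {ts = ts} generates all-one = contradiction 2≡1 λ ()
      where
        two : F q
        two = Fin.fromℕ< 3≤q
        two≢0 : Nonzero q two
        two≢0 two≡0 = contradiction (≡.trans (≡.sym (toℕ-fromℕ< 3≤q)) two≡0) λ ()
        inv-1# : inv q 1# ≡ 1#
        inv-1# = ≡.trans (≡.sym (*-identityˡ _)) (inv-inverseʳ λ 1≡0 → contradiction (≡.trans (≡.sym toℕ-1#) 1≡0) λ ())
        generated≡1# : ∀ {z} → InGenU q ts z → z ≡ 1#
        generated≡1# (gen z∈)     = all-one _ z∈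
        generated≡1# unit         = refl
        generated≡1# (mul y∈ z∈)  = ≡.trans (cong₂ _*_ (generated≡1# y∈) (generated≡1# z∈)) (*-identityˡ 1#)
        generated≡1# (inverse z∈) = ≡.trans (cong (inv q) (generated≡1# z∈)) inv-1#
        2≡1 : 2 ≡ 1
        2≡1 = ≡.trans (≡.sym (toℕ-fromℕ< 3≤q)) (≡.trans (cong toℕ (generated≡1# (generates two two≢0))) toℕ-1#)

    HasSize-Fiber : ∀ {s} (ts : Vec (F q × F q) (suc s)) → AllU q ts × GeneratesU q ts →
                    HasSize (Fiber q ts) (fiberSize s)
    HasSize-Fiber ts (all-u , generates) =
      HasSize-cong (ShiftedFiber⇔Fiber ts all-u generates) (HasSize-ShiftedFiber ts (GeneratesU⇒¬AllOne generates) 0#)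

    generators⇒InImage : ∀ {s} (ts : Vec (F q × F q) (suc s)) → AllU q ts × GeneratesU q ts → InImage q ts
    generators⇒InImage {s} ts generators = HasSize⇒Σ {{fiberSize≢0}} (HasSize-Fiber ts generators)
      where
        instance
          q-1≢0 : NonZero (q ∸ 1)
          q-1≢0 = ℕ.>-nonZero (ℕₚ.m<n⇒0<n∸m 1<q)
        fiberSize≢0 : NonZero (fiberSize s)
        fiberSize≢0 = ℕₚ.m*n≢0 _ _ {{ℕₚ.m^n≢0 (q ℕ.* q) s {{ℕₚ.m*n≢0 q q}}}}
                                   {{ℕₚ.m*n≢0 q (q ∸ 1)}}

lemma2p11 : (q : ℕ) .{{_ : NonZero q}} → Prime q → 3 ≤ q → (s : ℕ) → 1 ≤ s →
    ((ts : Vec (F q × F q) s) → InImage q ts ⇔ (AllU q ts × GeneratesU q ts))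
    × Σ ℕ (λ N → (ts : Vec (F q × F q) s) → InImage q ts → HasSize (Fiber q ts) N)
lemma2p11 q q-prime 3≤q (suc s) (s≤s z≤n) =
  (λ ts → mk⇔ (InImage⇒generators q q-prime ts) (generators⇒InImage q q-prime 3≤q ts)) ,
  (fiberSize q q-prime s , λ ts im → HasSize-Fiber q q-prime 3≤q ts (InImage⇒generators q q-prime ts im))
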